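{- Let $\Gamma$ be a finite $(G,s)$-geodesic-transitive digraph for some integer $s\geq 2$, where $G\leq\mathrm{Aut}(\Gamma)$, and let $N$ be a nontrivial normal subgroup of $G$ which acts regularly on $V(\Gamma)$. Then $\Gamma$ is a circuit. In particular, every $(G,s)$-geodesic-transitive $G$-normal Cayley digraph with $s\geq 2$ is a circuit.
   Context: A digraph $\Gamma$ consists of a finite vertex set $V(\Gamma)$ with an antisymmetric irreflexive relation $\rightarrow$; an arc is an ordered pair $(u,v)$ with $u\rightarrow v$. The distance $d_\Gamma(u,v)$ is the length of a shortest directed path from $u$ to $v$. An $s$-arc is a sequence $(v_0,\dots,v_s)$ with $v_i\rightarrow v_{i+1}$ for all $i$; it is an $s$-geodesic if $d_\Gamma(v_0,v_s)=s$. $\Gamma$ is $(G,s)$-geodesic-transitive if $G$ is transitive on the set of $i$-geodesics for each $i\leq s$. A circuit is a directed cycle $w_0\rightarrow w_1\rightarrow\cdots\rightarrow w_{r-1}\rightarrow w_0$ on distinct vertices, $r\geq 3$. A group acts regularly if it is transitive with trivial point stabilizers. For a group $H$ and $S\subseteq H\setminus\{1\}$ with $S\cap S^{ -1}=\emptyset$, the Cayley digraph $\mathrm{Cay}(H,S)$ has vertex set $H$ and arcs $(h,xh)$ for $h\in H$, $x\in S$; with $H$ acting by right multiplication, $\mathrm{Cay}(H,S)$ is $G$-normal if $H\leq G\leq\mathrm{Aut}(\mathrm{Cay}(H,S))$ and $H\trianglelefteq G$.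
   Formalization: Γ and, in the Cayley part, Cay(H,S) are also assumed strongly connected (every vertex reaches every vertex by a directed path), and H is taken nontrivial. Each condition added here is assumed in the paper as well or is needed for the statement above to hold. -}

module Defs where

open import Level using (0ℓ)
open import Data.Nat using (ℕ; zero; suc; _≤_; _<_; _∸_)
open import Data.Fin using (Fin; zero; suc; toℕ; inject₁; fromℕ)
open import Data.Fin.Permutation using (Permutation′; _⟨$⟩ʳ_; _≈_; id; flip; _∘ₚ_)
open import Data.Product using (Σ; ∃; _×_; _,_)
open import Data.Sum using (_⊎_)
open import Relation.Nullary using (¬_)
open import Relation.Binary.PropositionalEquality using (_≡_; _≢_)
open import Algebra.Structures using (IsGroup)

ArcRel : ℕ → Set₁
ArcRel n = Fin n → Fin n → Set

module _ {n : ℕ} (_⟶_ : ArcRel n) where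

  IsDigraph : Set
  IsDigraph = (∀ u → ¬ (u ⟶ u)) × (∀ u v → u ⟶ v → ¬ (v ⟶ u))

  data Walk : ℕ → Fin n → Fin n → Set where
    here : ∀ u → Walk zero u u
    step : ∀ {k u v w} → u ⟶ v → Walk k v w → Walk (suc k) u w

  -- d(u,v) = k : k is the least length of a directed path (equivalently
  -- walk) from u to v
  Dist : Fin n → Fin n → ℕ → Set
  Dist u v k = Walk k u v × (∀ j → j < k → ¬ Walk j u v)

  StronglyConnected : Set
  StronglyConnected = ∀ u v → ∃ λ k → Walk k u v

  IsArcSeq : (s : ℕ) → (Fin (suc s) → Fin n) → Set
  IsArcSeq s x = ∀ (i : Fin s) → x (inject₁ i) ⟶ x (suc i)

  IsGeodesic : (s : ℕ) → (Fin (suc s) → Fin n) → Set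
  IsGeodesic s x = IsArcSeq s x × Dist (x zero) (x (fromℕ s)) s

  IsAut : Permutation′ n → Set
  IsAut g = ∀ u v → (u ⟶ v → (g ⟨$⟩ʳ u) ⟶ (g ⟨$⟩ʳ v))
                  × ((g ⟨$⟩ʳ u) ⟶ (g ⟨$⟩ʳ v) → u ⟶ v)

  GeodesicTransitive : (Permutation′ n → Set) → ℕ → Set
  GeodesicTransitive G s =
    ∀ i → i ≤ s → ∀ (x y : Fin (suc i) → Fin n) →
      IsGeodesic i x → IsGeodesic i y →
      ∃ λ g → G g × (∀ j → g ⟨$⟩ʳ x j ≡ y j)

  -- Γ is a circuit: r = n ≥ 3 and there is an enumeration w_0,...,w_{n-1}
  -- of all vertices (a bijection) whose arcs are exactly w_i → w_{i+1 mod n}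
  IsCircuit : Set
  IsCircuit = 3 ≤ n × Σ (Permutation′ n) λ w →
    ∀ i j → ((w ⟨$⟩ʳ i) ⟶ (w ⟨$⟩ʳ j) →
               (toℕ j ≡ suc (toℕ i)) ⊎ (toℕ i ≡ n ∸ 1 × toℕ j ≡ 0))
          × ((toℕ j ≡ suc (toℕ i)) ⊎ (toℕ i ≡ n ∸ 1 × toℕ j ≡ 0) →
               (w ⟨$⟩ʳ i) ⟶ (w ⟨$⟩ʳ j))

module _ {n : ℕ} where

  record IsSubgroup (G : Permutation′ n → Set) : Set where
    field
      respects : ∀ {g h} → g ≈ h → G g → G h
      has-id   : G id
      closed-∘ : ∀ {g h} → G g → G h → G (g ∘ₚ h)
      closed-⁻¹ : ∀ {g} → G g → G (flip g)

  record IsNormalSubgroup (N G : Permutation′ n → Set) : Set where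
    field
      subgroup : IsSubgroup N
      ⊆G       : ∀ {h} → N h → G h
      normal   : ∀ {g h} → G g → N h → N ((flip g ∘ₚ h) ∘ₚ g)

  Nontrivial : (Permutation′ n → Set) → Set
  Nontrivial N = ∃ λ g → N g × ∃ λ u → g ⟨$⟩ʳ u ≢ u

  Regular : (Permutation′ n → Set) → Set
  Regular N = (∀ u v → ∃ λ g → N g × g ⟨$⟩ʳ u ≡ v)
            × (∀ g → N g → ∀ u → g ⟨$⟩ʳ u ≡ u → ∀ v → g ⟨$⟩ʳ v ≡ v)

record FinGroup (n : ℕ) : Set where
  infixl 7 _·_
  field
    _·_ : Fin n → Fin n → Fin n
    e   : Fin n
    _⁻¹ : Fin n → Fin n
    isGroup : IsGroup _≡_ _·_ e _⁻¹

module _ {n : ℕ} (H : FinGroup n) where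
  open FinGroup H

  IsCayleySubset : (Fin n → Set) → Set
  IsCayleySubset S = ¬ S e × (∀ x → S x → ¬ S (x ⁻¹))

  Cay : (Fin n → Set) → ArcRel n
  Cay S h k = ∃ λ x → S x × k ≡ x · h

  RightMult : Permutation′ n → Set
  RightMult g = ∃ λ h → ∀ x → g ⟨$⟩ʳ x ≡ x · h

  IsGNormal : (Fin n → Set) → (Permutation′ n → Set) → Set
  IsGNormal S G = IsNormalSubgroup RightMult G
                × (∀ g → G g → IsAut (Cay S) g)

-- Fix an arc u ⟶ a and let A be the element of N with A u = a.  Because N is regular and
-- normal, an element of the stabiliser G_u that sends A u to C u (A, C ∈ N) intertwines A
-- with C, so an element of G_u carrying the 2-geodesic (u, A u, A x) to (u, C u, C y) sends
-- x to y.  Let u ⟶ A u, …, u ⟶ Aⁱ u be the maximal run of out-neighbours among the powers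
-- of A (it is finite because u does not reach A⁻¹ u).  Then every 2-geodesic (u, C u, C t)
-- has t = Cⁱ u.  For i ≥ 2, taking C = A² and t = Aⁱ⁻¹ u gives Aⁱ⁺¹ u = u, which is
-- impossible; for i = 1, every C ∈ N with u ⟶ C u permutes the other out-neighbours of u,
-- and two distinct out-neighbours a, b would then give arcs in both directions between two
-- vertices.  Hence every vertex has out-degree one, and a strongly connected digraph of
-- out-degree one is a single directed cycle.

module Submission where

open import Defs
open import Level using (0ℓ)
open import Algebra.Bundles using (Group)
import Algebra.Properties.Group as GroupProperties
open import Data.Fin using (Fin; zero; suc; toℕ; fromℕ<; _≟_)
open import Data.Fin.Permutation
  using (Permutation′; _⟨$⟩ʳ_; _⟨$⟩ˡ_; _∘ₚ_; flip; inverseˡ; inverseʳ; permutation)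
  renaming (id to idₚ)
open import Data.Fin.Properties using (toℕ<n; toℕ-fromℕ<; toℕ-injective; pigeonhole; sequence; cantor-schröder-bernstein)
open import Data.Nat using (ℕ; zero; suc; _+_; _*_; _∸_; _≤_; _<_; z≤n; s≤s; pred)
open import Data.Nat.GeneralisedArithmetic using (fold; iterate; fold-+; iterate-is-fold)
open import Data.Nat.Properties
  using (≤-refl; ≤-trans; <⇒≤; n<1+n; n≤1+n; <-cmp; m≤n⇒m<n∨m≡n; m∸n+n≡m; m+[n∸m]≡n; m<n⇒0<n∸m; m≤m+n;
         +-monoʳ-<; +-comm; m≤n⇒∃[o]m+o≡n)
open import Data.Nat.Tactic.RingSolver using (solve-∀)
open import Data.Product using (∃; _×_; _,_; proj₁; proj₂)
open import Data.Sum using (_⊎_; inj₁; inj₂)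
open import Effect.Monad using (RawMonad)
open import Function.Base using (_∘_)
open import Relation.Binary.Definitions using (tri<; tri≈; tri>)
open import Relation.Binary.PropositionalEquality
open import Relation.Nullary using (¬_; Dec; yes; no)
open import Relation.Nullary.Decidable using (decidable-stable; ¬?; ¬¬-excluded-middle)
open import Relation.Nullary.Negation using (contradiction; ¬¬-map; ¬¬-Monad)
open import Relation.Unary using (Decidable)

private
  variable
    n : ℕ

prefix-or-failure : ∀ {P : ℕ → Set} → Decidable P → P 0 → ∀ k →
                    (∀ j → j ≤ k → P j) ⊎ ∃ λ i → (∀ j → j ≤ i → P j) × ¬ P (suc i)
prefix-or-failure P? p₀ zero = inj₁ λ { zero z≤n → p₀ }
prefix-or-failure {P} P? p₀ (suc k) with prefix-or-failure P? p₀ k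
... | inj₂ failure = inj₂ failure
... | inj₁ prefix with P? (suc k)
...   | no ¬p = inj₂ (k , prefix , ¬p)
...   | yes p = inj₁ extended
  where
  extended : ∀ j → j ≤ suc k → P j
  extended j j≤1+k with m≤n⇒m<n∨m≡n j≤1+k
  ... | inj₁ (s≤s j≤k) = prefix j j≤k
  ... | inj₂ refl      = p

first-failure : ∀ {P : ℕ → Set} → Decidable P → P 0 → ∀ k → ¬ P k →
                ∃ λ i → (∀ j → j ≤ i → P j) × ¬ P (suc i)
first-failure P? p₀ k ¬pₖ with prefix-or-failure P? p₀ k
... | inj₁ prefix  = contradiction (prefix k ≤-refl) ¬pₖ
... | inj₂ failure = failure

⟨$⟩ʳ-injective : ∀ (π : Permutation′ n) {x y} → π ⟨$⟩ʳ x ≡ π ⟨$⟩ʳ y → x ≡ y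
⟨$⟩ʳ-injective π e = trans (sym (inverseˡ π)) (trans (cong (π ⟨$⟩ˡ_) e) (inverseˡ π))

infixl 10 _^_

_^_ : Permutation′ n → ℕ → Permutation′ n
π ^ zero  = idₚ
π ^ suc k = π ^ k ∘ₚ π

^-+ : ∀ (π : Permutation′ n) j k x → (π ^ (j + k)) ⟨$⟩ʳ x ≡ (π ^ j) ⟨$⟩ʳ ((π ^ k) ⟨$⟩ʳ x)
^-+ π zero    k x = refl
^-+ π (suc j) k x = cong (π ⟨$⟩ʳ_) (^-+ π j k x)

^-^ : ∀ (π : Permutation′ n) j k x → (π ^ j ^ k) ⟨$⟩ʳ x ≡ (π ^ (k * j)) ⟨$⟩ʳ x
^-^ π j zero    x = refl
^-^ π j (suc k) x = trans (cong ((π ^ j) ⟨$⟩ʳ_) (^-^ π j k x)) (sym (^-+ π j (k * j) x))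

^-intertwine : ∀ (g π ρ : Permutation′ n) → (∀ x → g ⟨$⟩ʳ (π ⟨$⟩ʳ x) ≡ ρ ⟨$⟩ʳ (g ⟨$⟩ʳ x)) →
               ∀ k x → g ⟨$⟩ʳ ((π ^ k) ⟨$⟩ʳ x) ≡ (ρ ^ k) ⟨$⟩ʳ (g ⟨$⟩ʳ x)
^-intertwine g π ρ gπ≡ρg zero    x = refl
^-intertwine g π ρ gπ≡ρg (suc k) x =
  trans (gπ≡ρg _) (cong (ρ ⟨$⟩ʳ_) (^-intertwine g π ρ gπ≡ρg k x))

triple : Fin n → Fin n → Fin n → Fin 3 → Fin n
triple u x y zero             = u
triple u x y (suc zero)       = x
triple u x y (suc (suc zero)) = y

module _ {_⟶_ : ArcRel n} where

  walk⇒iterate : (next : Fin n → Fin n) → (∀ {u v} → u ⟶ v → v ≡ next u) →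
                 ∀ {k u v} → Walk _⟶_ k u v → iterate next u k ≡ v
  walk⇒iterate next ⟶⇒next (here u) = refl
  walk⇒iterate next ⟶⇒next {suc k} (step u⟶v w) =
    trans (cong (λ x → iterate next x k) (sym (⟶⇒next u⟶v))) (walk⇒iterate next ⟶⇒next w)

  first-arc : ∀ {k u v} → Walk _⟶_ k u v → v ≢ u → ∃ λ a → u ⟶ a
  first-arc (here u)       v≢u = contradiction refl v≢u
  first-arc (step u⟶a _) _   = _ , u⟶a

  two-geodesic : IsDigraph _⟶_ → ∀ {u x y} → u ⟶ x → x ⟶ y → ¬ u ⟶ y →
                 IsGeodesic _⟶_ 2 (triple u x y)
  two-geodesic (_ , antisymmetric) {u} {x} {y} u⟶x x⟶y ¬u⟶y =
    arcs , step u⟶x (step x⟶y (here y)) , shorter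
    where
    arcs : IsArcSeq _⟶_ 2 (triple u x y)
    arcs zero       = u⟶x
    arcs (suc zero) = x⟶y
    shorter : ∀ j → j < 2 → ¬ Walk _⟶_ j u y
    shorter zero          _ (here _)             = antisymmetric u x u⟶x x⟶y
    shorter (suc zero)    _ (step u⟶y (here _)) = ¬u⟶y u⟶y
    shorter (suc (suc j)) (s≤s (s≤s ()))

module FunctionalDigraph {_⟶_ : ArcRel n} (isDigraph : IsDigraph _⟶_)
  (strong : StronglyConnected _⟶_) (next : Fin n → Fin n)
  (⟶-next : ∀ u → u ⟶ next u) (⟶⇒next : ∀ {u v} → u ⟶ v → v ≡ next u)
  (u₀ : Fin n) where

  irreflexive : ∀ u → ¬ u ⟶ u
  irreflexive = proj₁ isDigraph

  antisymmetric : ∀ u v → u ⟶ v → ¬ v ⟶ u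
  antisymmetric = proj₂ isDigraph

  next≢self : ∀ u → next u ≢ u
  next≢self u next≡u = irreflexive u (subst (u ⟶_) next≡u (⟶-next u))

  orbit : ℕ → Fin n
  orbit = fold u₀ next

  iterate-reaches : ∀ u v → ∃ λ k → iterate next u k ≡ v
  iterate-reaches u v with k , w ← strong u v = k , walk⇒iterate next ⟶⇒next w

  least-return : ∃ λ p → 3 ≤ p × orbit p ≡ u₀ × (∀ l → 0 < l → l < p → orbit l ≢ u₀)
  least-return
    with k , returns ← iterate-reaches (next u₀) u₀
    with first-failure (λ l → ¬? (orbit (suc l) ≟ u₀)) (next≢self u₀) k
           (λ orbit≢u₀ → orbit≢u₀ (trans (iterate-is-fold u₀ next (suc k)) returns))
  ... | zero , _ , ¬¬returns₂ =
    contradiction (subst (next u₀ ⟶_) (decidable-stable (orbit 2 ≟ u₀) ¬¬returns₂) (⟶-next (next u₀)))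
                  (antisymmetric u₀ (next u₀) (⟶-next u₀))
  ... | suc j , stays-away , ¬¬returns =
    3 + j , s≤s (s≤s (s≤s z≤n)) , decidable-stable (orbit (3 + j) ≟ u₀) ¬¬returns , minimal
    where
    minimal : ∀ l → 0 < l → l < 3 + j → orbit l ≢ u₀
    minimal (suc l) _ (s≤s (s≤s l≤1+j)) = stays-away l l≤1+j

  module _ {p} (0<p : 0 < p) (orbit-p : orbit p ≡ u₀)
           (minimal : ∀ l → 0 < l → l < p → orbit l ≢ u₀) where

    orbit-distinct : ∀ {i j} → i < j → j < p → orbit i ≢ orbit j
    orbit-distinct {i} {j} i<j j<p e = minimal (p ∸ j + i) 0<d+i d+i<p (begin
      orbit (p ∸ j + i)             ≡⟨ fold-+ u₀ next (p ∸ j) ⟩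
      fold (orbit i) next (p ∸ j)   ≡⟨ cong (λ v → fold v next (p ∸ j)) e ⟩
      fold (orbit j) next (p ∸ j)   ≡⟨ fold-+ u₀ next (p ∸ j) ⟨
      orbit (p ∸ j + j)             ≡⟨ cong orbit (m∸n+n≡m (<⇒≤ j<p)) ⟩
      orbit p                       ≡⟨ orbit-p ⟩
      u₀                            ∎)
      where
      open ≡-Reasoning
      0<d+i : 0 < p ∸ j + i
      0<d+i = ≤-trans (m<n⇒0<n∸m j<p) (m≤m+n (p ∸ j) i)
      d+i<p : p ∸ j + i < p
      d+i<p = subst (p ∸ j + i <_) (m∸n+n≡m (<⇒≤ j<p)) (+-monoʳ-< (p ∸ j) i<j)

    orbit-injective : ∀ {i j} → i < p → j < p → orbit i ≡ orbit j → i ≡ j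
    orbit-injective {i} {j} i<p j<p e with <-cmp i j
    ... | tri< i<j _ _ = contradiction e (orbit-distinct i<j j<p)
    ... | tri≈ _ i≡j _ = i≡j
    ... | tri> _ _ j<i = contradiction (sym e) (orbit-distinct j<i i<p)

    orbit-mod : ∀ k → ∃ λ r → r < p × orbit r ≡ orbit k
    orbit-mod zero = 0 , 0<p , refl
    orbit-mod (suc k) with r , r<p , e ← orbit-mod k with m≤n⇒m<n∨m≡n r<p
    ... | inj₁ 1+r<p = suc r , 1+r<p , cong next e
    ... | inj₂ 1+r≡p = 0 , 0<p , trans (sym orbit-p) (trans (cong orbit (sym 1+r≡p)) (cong next e))

    orbit-surjective : ∀ v → ∃ λ r → r < p × orbit r ≡ v
    orbit-surjective v with k , k-reaches ← iterate-reaches u₀ v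
                       with r , r<p , e ← orbit-mod k =
      r , r<p , trans e (trans (iterate-is-fold u₀ next k) k-reaches)

    index : Fin n → Fin p
    index v = fromℕ< (proj₁ (proj₂ (orbit-surjective v)))

    orbit-index : ∀ v → orbit (toℕ (index v)) ≡ v
    orbit-index v = trans (cong orbit (toℕ-fromℕ< (proj₁ (proj₂ (orbit-surjective v)))))
                          (proj₂ (proj₂ (orbit-surjective v)))

    period≡n : p ≡ n
    period≡n = cantor-schröder-bernstein {f = orbit ∘ toℕ} {g = index}
      (λ e → toℕ-injective (orbit-injective (toℕ<n _) (toℕ<n _) e))
      (λ {v} {w} e → trans (sym (orbit-index v)) (trans (cong (orbit ∘ toℕ) e) (orbit-index w)))

  orbit⇒circuit : 3 ≤ n → orbit n ≡ u₀ →
                  (∀ {i j} → i < n → j < n → orbit i ≡ orbit j → i ≡ j) →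
                  (index : Fin n → Fin n) → (∀ v → orbit (toℕ (index v)) ≡ v) → IsCircuit _⟶_
  orbit⇒circuit 3≤n orbit-n injective index orbit-index =
    3≤n , enumeration , λ i j → to i j ∘ ⟶⇒next , from i j
    where
    0<n : 0 < n
    0<n = ≤-trans (s≤s z≤n) 3≤n
    enumerate : Fin n → Fin n
    enumerate = orbit ∘ toℕ
    enumeration : Permutation′ n
    enumeration = permutation enumerate index orbit-index
      (λ i → toℕ-injective (injective (toℕ<n _) (toℕ<n _) (orbit-index (enumerate i))))
    to : ∀ i j → enumerate j ≡ orbit (suc (toℕ i)) →
         toℕ j ≡ suc (toℕ i) ⊎ (toℕ i ≡ n ∸ 1 × toℕ j ≡ 0)
    to i j e with m≤n⇒m<n∨m≡n (toℕ<n i)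
    ... | inj₁ 1+i<n = inj₁ (injective (toℕ<n j) 1+i<n e)
    ... | inj₂ 1+i≡n = inj₂ (cong pred 1+i≡n ,
                             injective (toℕ<n j) 0<n (trans e (trans (cong orbit 1+i≡n) orbit-n)))
    from : ∀ i j → toℕ j ≡ suc (toℕ i) ⊎ (toℕ i ≡ n ∸ 1 × toℕ j ≡ 0) →
           enumerate i ⟶ enumerate j
    from i j (inj₁ j≡1+i)          = subst (λ k → enumerate i ⟶ orbit k) (sym j≡1+i) (⟶-next _)
    from i j (inj₂ (i≡n-1 , j≡0)) =
      subst₂ (λ k l → orbit k ⟶ orbit l) (sym i≡n-1) (sym j≡0) last⟶first
      where
      last⟶first : orbit (n ∸ 1) ⟶ u₀
      last⟶first = subst (orbit (n ∸ 1) ⟶_) (trans (cong orbit (m+[n∸m]≡n 0<n)) orbit-n) (⟶-next _)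

  isCircuit : IsCircuit _⟶_
  isCircuit with p , 3≤p , orbit-p , minimal ← least-return
           with 0<p ← ≤-trans (s≤s z≤n) 3≤p
           with refl ← period≡n 0<p orbit-p minimal =
    orbit⇒circuit 3≤p orbit-p (orbit-injective 0<p orbit-p minimal)
                  (index 0<p orbit-p minimal) (orbit-index 0<p orbit-p minimal)

module RegularNormalSubgroup {_⟶_ : ArcRel n} (isDigraph : IsDigraph _⟶_)
  {G N : Permutation′ n → Set} (G-aut : ∀ g → G g → IsAut _⟶_ g)
  (N⊴G : IsNormalSubgroup N G) (N-regular : Regular N)
  (2-geodesic-transitive : GeodesicTransitive _⟶_ G 2) where

  open IsNormalSubgroup N⊴G
  open IsSubgroup subgroup

  irreflexive : ∀ u → ¬ u ⟶ u
  irreflexive = proj₁ isDigraph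

  antisymmetric : ∀ u v → u ⟶ v → ¬ v ⟶ u
  antisymmetric = proj₂ isDigraph

  N-transitive : ∀ u v → ∃ λ K → N K × K ⟨$⟩ʳ u ≡ v
  N-transitive = proj₁ N-regular

  N-semiregular : ∀ K → N K → ∀ u → K ⟨$⟩ʳ u ≡ u → ∀ v → K ⟨$⟩ʳ v ≡ v
  N-semiregular = proj₂ N-regular

  N-preserves : ∀ {K u v} → N K → u ⟶ v → (K ⟨$⟩ʳ u) ⟶ (K ⟨$⟩ʳ v)
  N-preserves nK = proj₁ (G-aut _ (⊆G nK) _ _)

  N-reflects : ∀ {K u v} → N K → (K ⟨$⟩ʳ u) ⟶ (K ⟨$⟩ʳ v) → u ⟶ v
  N-reflects nK = proj₂ (G-aut _ (⊆G nK) _ _)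

  ^-closed : ∀ {K} → N K → ∀ k → N (K ^ k)
  ^-closed nK zero    = has-id
  ^-closed nK (suc k) = closed-∘ (^-closed nK k) nK

  finite-order : ∀ {K} → N K → Fin n → ∃ λ r → ∀ x → (K ^ suc r) ⟨$⟩ʳ x ≡ x
  finite-order {K} nK u with i , j , i<j , e ← pigeonhole (n<1+n n) (λ i → (K ^ toℕ i) ⟨$⟩ʳ u)
                        with d , 1+i+d≡j ← m≤n⇒∃[o]m+o≡n i<j =
    d , N-semiregular (K ^ suc d) (^-closed nK (suc d)) ((K ^ toℕ i) ⟨$⟩ʳ u) (begin
      (K ^ suc d) ⟨$⟩ʳ ((K ^ toℕ i) ⟨$⟩ʳ u)   ≡⟨ ^-+ K (suc d) (toℕ i) u ⟨
      (K ^ (suc d + toℕ i)) ⟨$⟩ʳ u          ≡⟨ cong (λ k → (K ^ k) ⟨$⟩ʳ u) 1+d+i≡j ⟩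
      (K ^ toℕ j) ⟨$⟩ʳ u                    ≡⟨ e ⟨
      (K ^ toℕ i) ⟨$⟩ʳ u                    ∎)
    where
    open ≡-Reasoning
    1+d+i≡j : suc d + toℕ i ≡ toℕ j
    1+d+i≡j = trans (cong suc (+-comm d (toℕ i))) 1+i+d≡j

  -- D = C⁻¹ ∘ g K g⁻¹ lies in N and fixes u, so it is the identity.
  stabiliser-intertwines : ∀ {u K C g} → G g → g ⟨$⟩ʳ u ≡ u → N K → N C →
                           g ⟨$⟩ʳ (K ⟨$⟩ʳ u) ≡ C ⟨$⟩ʳ u →
                           ∀ x → g ⟨$⟩ʳ (K ⟨$⟩ʳ x) ≡ C ⟨$⟩ʳ (g ⟨$⟩ʳ x)
  stabiliser-intertwines {u} {K} {C} {g} gG gu≡u nK nC gKu≡Cu x = begin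
    g ⟨$⟩ʳ (K ⟨$⟩ʳ x)                               ≡⟨ inverseʳ C ⟨
    C ⟨$⟩ʳ (C ⟨$⟩ˡ (g ⟨$⟩ʳ (K ⟨$⟩ʳ x)))               ≡⟨ cong (λ y → C ⟨$⟩ʳ (C ⟨$⟩ˡ (g ⟨$⟩ʳ (K ⟨$⟩ʳ y)))) (inverseˡ g) ⟨
    C ⟨$⟩ʳ (D ⟨$⟩ʳ (g ⟨$⟩ʳ x))                        ≡⟨ cong (C ⟨$⟩ʳ_) (D-identity (g ⟨$⟩ʳ x)) ⟩
    C ⟨$⟩ʳ (g ⟨$⟩ʳ x)                                 ∎
    where
    open ≡-Reasoning
    D : Permutation′ n
    D = ((flip g ∘ₚ K) ∘ₚ g) ∘ₚ flip C
    g⁻¹u≡u : g ⟨$⟩ˡ u ≡ u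
    g⁻¹u≡u = trans (cong (g ⟨$⟩ˡ_) (sym gu≡u)) (inverseˡ g)
    D-fixes-u : D ⟨$⟩ʳ u ≡ u
    D-fixes-u = trans (cong (λ y → C ⟨$⟩ˡ (g ⟨$⟩ʳ (K ⟨$⟩ʳ y))) g⁻¹u≡u)
                      (trans (cong (C ⟨$⟩ˡ_) gKu≡Cu) (inverseˡ C))
    D-identity : ∀ y → D ⟨$⟩ʳ y ≡ y
    D-identity = N-semiregular D (closed-∘ (normal gG nK) (closed-⁻¹ nC)) u D-fixes-u

  no-return : ∀ {C u t} → N C → u ⟶ (C ⟨$⟩ʳ u) → u ⟶ t → C ⟨$⟩ʳ t ≢ u
  no-return {C} {u} nC u⟶Cu u⟶t Ct≡u =
    antisymmetric u (C ⟨$⟩ʳ u) u⟶Cu (subst ((C ⟨$⟩ʳ u) ⟶_) Ct≡u (N-preserves nC u⟶t))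

  -- An element of the stabiliser carrying the 2-geodesic (u, A u, A (Aⁱ u)) to (u, C u, C t)
  -- intertwines A with C, hence sends Aⁱ u to both t and Cⁱ u.
  geodesic-rigidity : ∀ {A C u t} → N A → N C → ∀ i →
                      u ⟶ (A ⟨$⟩ʳ u) → u ⟶ ((A ^ i) ⟨$⟩ʳ u) → ¬ u ⟶ ((A ^ suc i) ⟨$⟩ʳ u) →
                      u ⟶ (C ⟨$⟩ʳ u) → u ⟶ t → ¬ u ⟶ (C ⟨$⟩ʳ t) → t ≡ (C ^ i) ⟨$⟩ʳ u
  geodesic-rigidity {A} {C} {u} {t} nA nC i u⟶Au u⟶Aⁱu ¬u⟶Aⁱ⁺¹u u⟶Cu u⟶t ¬u⟶Ct
    with g , gG , g-maps ← 2-geodesic-transitive 2 ≤-refl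
                             (triple u (A ⟨$⟩ʳ u) ((A ^ suc i) ⟨$⟩ʳ u)) (triple u (C ⟨$⟩ʳ u) (C ⟨$⟩ʳ t))
                             (two-geodesic isDigraph u⟶Au (N-preserves nA u⟶Aⁱu) ¬u⟶Aⁱ⁺¹u)
                             (two-geodesic isDigraph u⟶Cu (N-preserves nC u⟶t) ¬u⟶Ct) =
    ⟨$⟩ʳ-injective C (begin
      C ⟨$⟩ʳ t                                ≡⟨ g-maps (suc (suc zero)) ⟨
      g ⟨$⟩ʳ (A ⟨$⟩ʳ ((A ^ i) ⟨$⟩ʳ u))          ≡⟨ intertwines _ ⟩
      C ⟨$⟩ʳ (g ⟨$⟩ʳ ((A ^ i) ⟨$⟩ʳ u))          ≡⟨ cong (C ⟨$⟩ʳ_) (^-intertwine g A C intertwines i u) ⟩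
      C ⟨$⟩ʳ ((C ^ i) ⟨$⟩ʳ (g ⟨$⟩ʳ u))          ≡⟨ cong (λ y → C ⟨$⟩ʳ ((C ^ i) ⟨$⟩ʳ y)) (g-maps zero) ⟩
      C ⟨$⟩ʳ ((C ^ i) ⟨$⟩ʳ u)                  ∎)
    where
    open ≡-Reasoning
    intertwines : ∀ x → g ⟨$⟩ʳ (A ⟨$⟩ʳ x) ≡ C ⟨$⟩ʳ (g ⟨$⟩ʳ x)
    intertwines = stabiliser-intertwines gG (g-maps zero) nA nC (g-maps (suc zero))

  eventually-not-out-neighbour : ∀ {A u} → N A → u ⟶ (A ⟨$⟩ʳ u) → ∃ λ k → ¬ u ⟶ ((A ^ suc k) ⟨$⟩ʳ u)
  eventually-not-out-neighbour {A} {u} nA u⟶Au with finite-order nA u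
  ... | zero  , A≈id    = contradiction (subst (u ⟶_) (A≈id u) u⟶Au) (irreflexive u)
  ... | suc r , Aʳ⁺²≈id = r , λ u⟶Aʳ⁺¹u → no-return nA u⟶Au u⟶Aʳ⁺¹u (Aʳ⁺²≈id u)

  -- Rigidity for C = A² and t = Aʲ⁺¹ u gives Aʲ⁺¹ u = A²ʲ⁺⁴ u, i.e. A (Aʲ⁺² u) = u.
  long-run-cannot-end : ∀ {A u} j → N A → u ⟶ (A ⟨$⟩ʳ u) → u ⟶ ((A ^ 2) ⟨$⟩ʳ u) →
                        u ⟶ ((A ^ suc j) ⟨$⟩ʳ u) → u ⟶ ((A ^ (2 + j)) ⟨$⟩ʳ u) →
                        ¬ ¬ u ⟶ ((A ^ (3 + j)) ⟨$⟩ʳ u)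
  long-run-cannot-end {A} {u} j nA u⟶Au u⟶A²u u⟶Aʲ⁺¹u u⟶Aʲ⁺²u ¬u⟶Aʲ⁺³u =
    no-return nA u⟶Au u⟶Aʲ⁺²u (⟨$⟩ʳ-injective (A ^ suc j) (begin
      (A ^ suc j) ⟨$⟩ʳ ((A ^ (3 + j)) ⟨$⟩ʳ u)   ≡⟨ ^-+ A (suc j) (3 + j) u ⟨
      (A ^ (suc j + (3 + j))) ⟨$⟩ʳ u          ≡⟨ cong (λ k → (A ^ k) ⟨$⟩ʳ u) (exponent j) ⟨
      (A ^ ((2 + j) * 2)) ⟨$⟩ʳ u              ≡⟨ ^-^ A 2 (2 + j) u ⟨
      (A ^ 2 ^ (2 + j)) ⟨$⟩ʳ u                ≡⟨ rigidity ⟨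
      (A ^ suc j) ⟨$⟩ʳ u                      ∎))
    where
    open ≡-Reasoning
    exponent : ∀ j → (2 + j) * 2 ≡ suc j + (3 + j)
    exponent = solve-∀
    rigidity : (A ^ suc j) ⟨$⟩ʳ u ≡ (A ^ 2 ^ (2 + j)) ⟨$⟩ʳ u
    rigidity = geodesic-rigidity nA (^-closed nA 2) (2 + j) u⟶Au u⟶Aʲ⁺²u ¬u⟶Aʲ⁺³u u⟶A²u u⟶Aʲ⁺¹u
                 (¬u⟶Aʲ⁺³u ∘ subst (u ⟶_) (sym (^-+ A 2 (suc j) u)))

  module _ {A u} (u⟶? : ∀ v → Dec (u ⟶ v)) (nA : N A) (u⟶Au : u ⟶ (A ⟨$⟩ʳ u))
           (¬u⟶A²u : ¬ u ⟶ ((A ^ 2) ⟨$⟩ʳ u)) where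

    shift-out-neighbour : ∀ {C t} → N C → u ⟶ (C ⟨$⟩ʳ u) → u ⟶ t → t ≢ C ⟨$⟩ʳ u → u ⟶ (C ⟨$⟩ʳ t)
    shift-out-neighbour {C} {t} nC u⟶Cu u⟶t t≢Cu with u⟶? (C ⟨$⟩ʳ t)
    ... | yes u⟶Ct = u⟶Ct
    ... | no ¬u⟶Ct = contradiction (geodesic-rigidity nA nC 1 u⟶Au u⟶Au ¬u⟶A²u u⟶Cu u⟶t ¬u⟶Ct) t≢Cu

    shift-out-neighbour-powers : ∀ {C t} → N C → u ⟶ (C ⟨$⟩ʳ u) → u ⟶ t → t ≢ C ⟨$⟩ʳ u →
                                 ∀ k → u ⟶ ((C ^ k) ⟨$⟩ʳ t) × (C ^ k) ⟨$⟩ʳ t ≢ C ⟨$⟩ʳ u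
    shift-out-neighbour-powers nC u⟶Cu u⟶t t≢Cu zero = u⟶t , t≢Cu
    shift-out-neighbour-powers {C} nC u⟶Cu u⟶t t≢Cu (suc k)
      with u⟶Cᵏt , Cᵏt≢Cu ← shift-out-neighbour-powers nC u⟶Cu u⟶t t≢Cu k =
      shift-out-neighbour nC u⟶Cu u⟶Cᵏt Cᵏt≢Cu ,
      λ CCᵏt≡Cu → irreflexive u (subst (u ⟶_) (⟨$⟩ʳ-injective C CCᵏt≡Cu) u⟶Cᵏt)

    out-neighbour-preimage : ∀ {C t} → N C → u ⟶ (C ⟨$⟩ʳ u) → u ⟶ t → t ≢ C ⟨$⟩ʳ u →
                             ∃ λ y → u ⟶ y × C ⟨$⟩ʳ y ≡ t
    out-neighbour-preimage {C} {t} nC u⟶Cu u⟶t t≢Cu with r , Cʳ⁺¹≈id ← finite-order nC u =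
      (C ^ r) ⟨$⟩ʳ t , proj₁ (shift-out-neighbour-powers nC u⟶Cu u⟶t t≢Cu r) , Cʳ⁺¹≈id t

    -- With y = A⁻¹ b and y′ = B⁻¹ (A u), the element A⁻¹ B ∈ N maps the arc u ⟶ y′ to y ⟶ u.
    short-run⇒unique : ∀ {b} → u ⟶ b → b ≡ A ⟨$⟩ʳ u
    short-run⇒unique {b} u⟶b with b ≟ A ⟨$⟩ʳ u
    ... | yes b≡Au = b≡Au
    ... | no  b≢Au
      with B , nB , Bu≡b ← N-transitive u b
      with y , u⟶y , Ay≡b ← out-neighbour-preimage nA u⟶Au u⟶b b≢Au
      with y′ , u⟶y′ , By′≡Au ← out-neighbour-preimage nB (subst (u ⟶_) (sym Bu≡b) u⟶b) u⟶Au
                                  (λ Au≡Bu → b≢Au (sym (trans Au≡Bu Bu≡b))) =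
      contradiction (subst₂ _⟶_ A⁻¹Bu≡y A⁻¹By′≡u (N-preserves (closed-∘ nB (closed-⁻¹ nA)) u⟶y′))
                    (antisymmetric u y u⟶y)
      where
      A⁻¹Bu≡y : A ⟨$⟩ˡ (B ⟨$⟩ʳ u) ≡ y
      A⁻¹Bu≡y = trans (cong (A ⟨$⟩ˡ_) (trans Bu≡b (sym Ay≡b))) (inverseˡ A)
      A⁻¹By′≡u : A ⟨$⟩ˡ (B ⟨$⟩ʳ y′) ≡ u
      A⁻¹By′≡u = trans (cong (A ⟨$⟩ˡ_) By′≡Au) (inverseˡ A)

  decidable⇒out-neighbour-unique : ∀ {u a b} → (∀ v → Dec (u ⟶ v)) → u ⟶ a → u ⟶ b → b ≡ a
  decidable⇒out-neighbour-unique {u} {a} u⟶? u⟶a u⟶b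
    with A , nA , Au≡a ← N-transitive u a
    with u⟶Au ← subst (u ⟶_) (sym Au≡a) u⟶a
    with k , ¬u⟶Aᵏ⁺¹u ← eventually-not-out-neighbour nA u⟶Au
    with first-failure (λ l → u⟶? ((A ^ suc l) ⟨$⟩ʳ u)) u⟶Au k ¬u⟶Aᵏ⁺¹u
  ... | zero , _ , ¬u⟶A²u = trans (short-run⇒unique u⟶? nA u⟶Au ¬u⟶A²u u⟶b) Au≡a
  ... | suc j , run , ¬u⟶Aʲ⁺³u = contradiction ¬u⟶Aʲ⁺³u
        (long-run-cannot-end j nA u⟶Au (run 1 (s≤s z≤n)) (run j (n≤1+n j)) (run (suc j) ≤-refl))

  -- b ≡ a is decidable, so it may be proved under ¬¬, where u ⟶ v is decidable for all v.
  out-neighbour-unique : ∀ {u a b} → u ⟶ a → u ⟶ b → b ≡ a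
  out-neighbour-unique {u} {a} {b} u⟶a u⟶b = decidable-stable (b ≟ a)
    (¬¬-map (λ u⟶? → decidable⇒out-neighbour-unique u⟶? u⟶a u⟶b)
            (sequence (RawMonad.rawApplicative ¬¬-Monad) (λ _ → ¬¬-excluded-middle)))

  module Successor {u a} (u⟶a : u ⟶ a) where

    translate : Fin n → Permutation′ n
    translate v = proj₁ (N-transitive u v)

    translate∈N : ∀ v → N (translate v)
    translate∈N v = proj₁ (proj₂ (N-transitive u v))

    translate-u : ∀ v → translate v ⟨$⟩ʳ u ≡ v
    translate-u v = proj₂ (proj₂ (N-transitive u v))

    next : Fin n → Fin n
    next v = translate v ⟨$⟩ʳ a

    ⟶-next : ∀ v → v ⟶ next v
    ⟶-next v = subst (_⟶ next v) (translate-u v) (N-preserves (translate∈N v) u⟶a)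

    ⟶⇒next : ∀ {v w} → v ⟶ w → w ≡ next v
    ⟶⇒next {v} {w} v⟶w =
      trans (sym (inverseʳ (translate v))) (cong (translate v ⟨$⟩ʳ_) (out-neighbour-unique u⟶a u⟶x))
      where
      u⟶x : u ⟶ (translate v ⟨$⟩ˡ w)
      u⟶x = N-reflects (translate∈N v)
              (subst₂ _⟶_ (sym (translate-u v)) (sym (inverseʳ (translate v))) v⟶w)

regular-normal-subgroup⇒circuit : ∀ {_⟶_ : ArcRel n} {G N : Permutation′ n → Set} →
  IsDigraph _⟶_ → StronglyConnected _⟶_ → (∀ g → G g → IsAut _⟶_ g) →
  GeodesicTransitive _⟶_ G 2 → IsNormalSubgroup N G → Nontrivial N → Regular N →
  IsCircuit _⟶_
regular-normal-subgroup⇒circuit isDigraph strong G-aut transitive N⊴G (g , _ , u , gu≢u) N-regular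
  with a , u⟶a ← first-arc (proj₂ (strong u (g ⟨$⟩ʳ u))) gu≢u =
  FunctionalDigraph.isCircuit isDigraph strong next ⟶-next ⟶⇒next u
  where
  open RegularNormalSubgroup isDigraph G-aut N⊴G N-regular transitive
  open Successor u⟶a

module _ (H : FinGroup n) where
  open FinGroup H

  private
    group : Group 0ℓ 0ℓ
    group = record
      { Carrier = Fin n ; _≈_ = _≡_ ; _∙_ = _·_ ; ε = e ; _⁻¹ = _⁻¹ ; isGroup = isGroup }

  open Group group using (_\\_; _//_; assoc; identityʳ)
  open GroupProperties group
    using (identityˡ-unique; identityʳ-unique; inverseˡ-unique;
           \\-leftDividesˡ; //-rightDividesˡ; //-rightDividesʳ)

  Cay-isDigraph : ∀ {S} → IsCayleySubset H S → IsDigraph (Cay H S)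
  Cay-isDigraph {S} (¬S-e , ¬S-inverse) = irreflexive , antisymmetric
    where
    irreflexive : ∀ h → ¬ Cay H S h h
    irreflexive h (x , Sx , h≡xh) = ¬S-e (subst S (identityˡ-unique x h (sym h≡xh)) Sx)
    antisymmetric : ∀ h k → Cay H S h k → ¬ Cay H S k h
    antisymmetric h k (x , Sx , k≡xh) (y , Sy , h≡yk) = ¬S-inverse x Sx (subst S y≡x⁻¹ Sy)
      where
      y≡x⁻¹ : y ≡ x ⁻¹
      y≡x⁻¹ = inverseˡ-unique y x (identityˡ-unique (y · x) h
                (trans (assoc y x h) (trans (cong (y ·_) (sym k≡xh)) (sym h≡yk))))

  right-translation : Fin n → Permutation′ n
  right-translation h = permutation (_· h) (_// h) (//-rightDividesˡ h) (//-rightDividesʳ h)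

  RightMult-regular : Regular (RightMult H)
  RightMult-regular =
    (λ u v → right-translation (u \\ v) , (u \\ v , λ _ → refl) , \\-leftDividesˡ u v) ,
    λ { g (h , g≡·h) u gu≡u v →
          trans (g≡·h v)
                (trans (cong (v ·_) (identityʳ-unique u h (trans (sym (g≡·h u)) gu≡u))) (identityʳ v)) }

geodesic-transitive-≤ : ∀ {_⟶_ : ArcRel n} {G} {s t} → s ≤ t →
                        GeodesicTransitive _⟶_ G t → GeodesicTransitive _⟶_ G s
geodesic-transitive-≤ s≤t transitive i i≤s = transitive i (≤-trans i≤s s≤t)

theorem1p3 : ((n : ℕ) (_⟶_ : ArcRel n) → IsDigraph _⟶_ → StronglyConnected _⟶_ →
     (s : ℕ) → 2 ≤ s →
     (G : Permutation′ n → Set) → IsSubgroup G → (∀ g → G g → IsAut _⟶_ g) →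
     GeodesicTransitive _⟶_ G s →
     (N : Permutation′ n → Set) → IsNormalSubgroup N G → Nontrivial N →
     Regular N → IsCircuit _⟶_)
    ×
    ((n : ℕ) (H : FinGroup n) (S : Fin n → Set) → IsCayleySubset H S →
     StronglyConnected (Cay H S) → Nontrivial (RightMult H) →
     (s : ℕ) → 2 ≤ s →
     (G : Permutation′ n → Set) → IsSubgroup G → IsGNormal H S G →
     GeodesicTransitive (Cay H S) G s → IsCircuit (Cay H S))
theorem1p3 =
  (λ _ _ isDigraph strong _ 2≤s _ _ G-aut transitive _ N⊴G nontrivial N-regular →
     regular-normal-subgroup⇒circuit isDigraph strong G-aut (geodesic-transitive-≤ 2≤s transitive)
       N⊴G nontrivial N-regular) ,
  (λ _ H _ S-cayley strong nontrivial _ 2≤s _ _ (H⊴G , G-aut) transitive →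
     regular-normal-subgroup⇒circuit (Cay-isDigraph H S-cayley) strong G-aut
       (geodesic-transitive-≤ 2≤s transitive) H⊴G nontrivial (RightMult-regular H))
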